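{- Let $m,n,k,d,\ell$ be positive integers satisfying $n+\ell-2k\ge 0$, $n>k\ge\ell\ge d\ge 2$, $m\ge 2$ and $k(n-k)\ge m\binom{k}{d}$. Then $\ell(n+\ell-2k)\ge m\binom{\ell}{d}$, and the inequality is strict if $k(n-k)>m\binom{k}{d}$. -}

module Defs where

{-# OPTIONS --safe #-}
module Submission where

-- By absorption, d·C(k,d) = k·C(k−1,d−1), the hypothesis is equivalent to the
-- reduced bound m·C(k−1,d−1) ≤ d(n−k) and the conclusion to m·C(ℓ−1,d−1) ≤ d(n+ℓ−2k).
-- Write k = ℓ + j, so that n − k and n + ℓ − 2k differ by j.  Lowering k and n − k
-- by one together costs d on the right, while by Pascal's rule the left drops by
-- m·C(k−2,d−2) ≥ 2(d−1) ≥ d; after j such steps one arrives at the conclusion.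
-- A slack t added on the left survives every step, so t = 1 gives the strict version.

open import Defs
open import Data.Nat using (ℕ; _+_; _*_; _∸_; _≤_; _<_)
open import Data.Nat.Combinatorics using (_C_)
open import Data.Product using (_×_)

open import Data.Nat using (zero; suc; NonZero; s≤s; z≤n)
open import Data.Nat.Combinatorics using (nC1≡n; nCk+nC[k+1]≡[n+1]C[k+1])
open import Data.Nat.Properties
open import Algebra.Properties.CommutativeSemigroup *-commutativeSemigroup
  using (x∙yz≈y∙xz)
open import Data.Nat.Tactic.RingSolver using (solve-∀)
open import Data.Product using (_,_; ∃₂)
open import Relation.Binary.PropositionalEquality

[k+1]*[n+1]C[k+1]≡[n+1]*nCk : ∀ n k → suc k * (suc n C suc k) ≡ suc n * (n C k)
[k+1]*[n+1]C[k+1]≡[n+1]*nCk zero    zero    = refl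
[k+1]*[n+1]C[k+1]≡[n+1]*nCk zero    (suc k) = *-zeroʳ (suc (suc k))
[k+1]*[n+1]C[k+1]≡[n+1]*nCk (suc n) zero    = begin
  1 * (suc (suc n) C 1)  ≡⟨ *-identityˡ _ ⟩
  suc (suc n) C 1        ≡⟨ nC1≡n (suc (suc n)) ⟩
  suc (suc n)            ≡⟨ *-identityʳ (suc (suc n)) ⟨
  suc (suc n) * 1        ∎
  where open ≡-Reasoning
[k+1]*[n+1]C[k+1]≡[n+1]*nCk (suc n) (suc k) = begin
  suc (suc k) * (suc (suc n) C suc (suc k))
    ≡⟨ cong (suc (suc k) *_) (nCk+nC[k+1]≡[n+1]C[k+1] (suc n) (suc k)) ⟨
  suc (suc k) * (suc n C suc k + suc n C suc (suc k))
    ≡⟨ split k (suc n C suc k) (suc n C suc (suc k)) ⟩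
  suc k * (suc n C suc k) + suc n C suc k + suc (suc k) * (suc n C suc (suc k))
    ≡⟨ cong₂ (λ x y → x + suc n C suc k + y)
             ([k+1]*[n+1]C[k+1]≡[n+1]*nCk n k) ([k+1]*[n+1]C[k+1]≡[n+1]*nCk n (suc k)) ⟩
  suc n * (n C k) + suc n C suc k + suc n * (n C suc k)
    ≡⟨ cong (λ x → suc n * (n C k) + x + suc n * (n C suc k))
            (nCk+nC[k+1]≡[n+1]C[k+1] n k) ⟨
  suc n * (n C k) + (n C k + n C suc k) + suc n * (n C suc k)
    ≡⟨ merge n (n C k) (n C suc k) ⟩
  suc (suc n) * (n C k + n C suc k)
    ≡⟨ cong (suc (suc n) *_) (nCk+nC[k+1]≡[n+1]C[k+1] n k) ⟩
  suc (suc n) * (suc n C suc k)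
    ∎
  where
  open ≡-Reasoning
  split : ∀ k x y → suc (suc k) * (x + y) ≡ suc k * x + x + suc (suc k) * y
  split = solve-∀
  merge : ∀ n x y → suc n * x + (x + y) + suc n * y ≡ suc (suc n) * (x + y)
  merge = solve-∀

k≤n⇒0<nCk : ∀ {n k} → k ≤ n → 0 < n C k
k≤n⇒0<nCk {n}     {zero}  _         = s≤s z≤n
k≤n⇒0<nCk {suc n} {suc k} (s≤s k≤n) =
  subst (0 <_) (nCk+nC[k+1]≡[n+1]C[k+1] n k) (≤-trans (k≤n⇒0<nCk k≤n) (m≤m+n _ _))

k<n⇒k<nCk : ∀ {n k} → k < n → k < n C k
k<n⇒k<nCk {n}     {zero}  _         = s≤s z≤n
k<n⇒k<nCk {suc n} {suc k} (s≤s k<n) =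
  subst (suc k <_) (nCk+nC[k+1]≡[n+1]C[k+1] n k)
        (≤-<-trans (k<n⇒k<nCk k<n) (m<m+n (n C k) (k≤n⇒0<nCk k<n)))

2+k≤m*nCk : ∀ {m n k} → 2 ≤ m → k < n → 2 + k ≤ m * (n C k)
2+k≤m*nCk {m} {n} {k} 2≤m k<n = begin
  2 + k          ≤⟨ m≤m+n (2 + k) k ⟩
  2 + k + k      ≡⟨ 2+k+k≡2*[1+k] k ⟩
  2 * suc k      ≤⟨ *-mono-≤ 2≤m (k<n⇒k<nCk k<n) ⟩
  m * (n C k)    ∎
  where
  open ≤-Reasoning
  2+k+k≡2*[1+k] : ∀ k → 2 + k + k ≡ 2 * suc k
  2+k+k≡2*[1+k] = solve-∀

cross-multiply-≤ : ∀ {m u v x} p q .{{_ : NonZero q}} →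
  p * u ≡ q * v → m * u ≤ q * x → m * v ≤ p * x
cross-multiply-≤ {m} {u} {v} {x} p q pu≡qv mu≤qx = *-cancelˡ-≤ q (begin
  q * (m * v)    ≡⟨ x∙yz≈y∙xz q m v ⟩
  m * (q * v)    ≡⟨ cong (m *_) pu≡qv ⟨
  m * (p * u)    ≡⟨ x∙yz≈y∙xz m p u ⟩
  p * (m * u)    ≤⟨ *-monoʳ-≤ p mu≤qx ⟩
  p * (q * x)    ≡⟨ x∙yz≈y∙xz p q x ⟩
  q * (p * x)    ∎)
  where open ≤-Reasoning

cross-multiply-< : ∀ {m u v x} p q .{{_ : NonZero p}} →
  p * u ≡ q * v → m * u < q * x → m * v < p * x
cross-multiply-< {m} {u} {v} {x} p q pu≡qv mu<qx = *-cancelˡ-< q _ _ (begin-strict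
  q * (m * v)    ≡⟨ x∙yz≈y∙xz q m v ⟩
  m * (q * v)    ≡⟨ cong (m *_) pu≡qv ⟨
  m * (p * u)    ≡⟨ x∙yz≈y∙xz m p u ⟩
  p * (m * u)    <⟨ *-monoʳ-< p mu<qx ⟩
  p * (q * x)    ≡⟨ x∙yz≈y∙xz p q x ⟩
  q * (p * x)    ∎)
  where open ≤-Reasoning

-- In the reduced bounds d is written 2 + f, so that C(_, f) is the term C(_, d − 2).
reduced-bound-step : ∀ {m f a t X} → 2 ≤ m → f < a →
  t + m * (suc a C suc f) ≤ (2 + f) * suc X → t + m * (a C suc f) ≤ (2 + f) * X
reduced-bound-step {m} {f} {a} {t} {X} 2≤m f<a h = +-cancelˡ-≤ (2 + f) _ _ (begin
  2 + f + (t + m * (a C suc f))            ≤⟨ +-monoˡ-≤ _ (2+k≤m*nCk 2≤m f<a) ⟩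
  m * (a C f) + (t + m * (a C suc f))      ≡⟨ regroup m t (a C f) (a C suc f) ⟩
  t + m * (a C f + a C suc f)              ≡⟨ cong (λ c → t + m * c) pascal ⟩
  t + m * (suc a C suc f)                  ≤⟨ h ⟩
  (2 + f) * suc X                          ≡⟨ *-suc (2 + f) X ⟩
  2 + f + (2 + f) * X                      ∎)
  where
  open ≤-Reasoning
  pascal : a C f + a C suc f ≡ suc a C suc f
  pascal = nCk+nC[k+1]≡[n+1]C[k+1] a f
  regroup : ∀ m t x y → m * x + (t + m * y) ≡ t + m * (x + y)
  regroup = solve-∀

reduced-bound-descends : ∀ {m f a t X} → 2 ≤ m → f < a → ∀ j →
  t + m * ((j + a) C suc f) ≤ (2 + f) * (j + X) → t + m * (a C suc f) ≤ (2 + f) * X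
reduced-bound-descends 2≤m f<a zero    h = h
reduced-bound-descends 2≤m f<a (suc j) h = reduced-bound-descends 2≤m f<a j
  (reduced-bound-step 2≤m (<-≤-trans f<a (m≤n+m _ j)) h)

bound-descends-≤ : ∀ {m d ℓ} → 2 ≤ m → 2 ≤ d → d ≤ ℓ → ∀ j A →
  m * ((j + ℓ) C d) ≤ (j + ℓ) * (j + A) → m * (ℓ C d) ≤ ℓ * A
bound-descends-≤ {m} {suc (suc f)} {suc a} 2≤m (s≤s (s≤s _)) (s≤s f<a) j A
  rewrite +-suc j a = λ h →
  cross-multiply-≤ {m} (suc a) (2 + f) (sym ([k+1]*[n+1]C[k+1]≡[n+1]*nCk a (suc f)))
    (reduced-bound-descends {t = 0} 2≤m f<a j
      (cross-multiply-≤ {m} (2 + f) (suc (j + a))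
        ([k+1]*[n+1]C[k+1]≡[n+1]*nCk (j + a) (suc f)) h))

bound-descends-< : ∀ {m d ℓ} → 2 ≤ m → 2 ≤ d → d ≤ ℓ → ∀ j A →
  m * ((j + ℓ) C d) < (j + ℓ) * (j + A) → m * (ℓ C d) < ℓ * A
bound-descends-< {m} {suc (suc f)} {suc a} 2≤m (s≤s (s≤s _)) (s≤s f<a) j A
  rewrite +-suc j a = λ h →
  cross-multiply-< {m} (suc a) (2 + f) (sym ([k+1]*[n+1]C[k+1]≡[n+1]*nCk a (suc f)))
    (reduced-bound-descends {t = 1} 2≤m f<a j
      (cross-multiply-< {m} (2 + f) (suc (j + a))
        ([k+1]*[n+1]C[k+1]≡[n+1]*nCk (j + a) (suc f)) h))

coordinates : ∀ {n k ℓ} → ℓ ≤ k → 2 * k ≤ n + ℓ →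
  ∃₂ λ j A → k ≡ j + ℓ × n ∸ k ≡ j + A × (n + ℓ) ∸ (2 * k) ≡ A
coordinates {n} {ℓ = ℓ} ℓ≤k 2k≤n+ℓ
  with m≤n⇒∃[o]m+o≡n ℓ≤k | m≤n⇒∃[o]m+o≡n 2k≤n+ℓ
... | j , refl | A , 2k+A≡n+ℓ = j , A , +-comm ℓ j , n∸k≡j+A , n+ℓ∸2k≡A
  where
  rearrange : ∀ ℓ j A → ℓ + j + (j + A) + ℓ ≡ 2 * (ℓ + j) + A
  rearrange = solve-∀
  n≡k+[j+A] : n ≡ ℓ + j + (j + A)
  n≡k+[j+A] = +-cancelʳ-≡ ℓ n _ (sym (trans (rearrange ℓ j A) 2k+A≡n+ℓ))
  n∸k≡j+A : n ∸ (ℓ + j) ≡ j + A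
  n∸k≡j+A = trans (cong (_∸ (ℓ + j)) n≡k+[j+A]) (m+n∸m≡n (ℓ + j) (j + A))
  n+ℓ∸2k≡A : (n + ℓ) ∸ (2 * (ℓ + j)) ≡ A
  n+ℓ∸2k≡A = trans (cong (_∸ (2 * (ℓ + j))) (sym 2k+A≡n+ℓ))
                   (m+n∸m≡n (2 * (ℓ + j)) A)

lemma3p5 : (m n k d ℓ : ℕ) →
    2 * k ≤ n + ℓ → k < n → ℓ ≤ k → d ≤ ℓ → 2 ≤ d → 2 ≤ m →
    m * (k C d) ≤ k * (n ∸ k) →
    (m * (ℓ C d) ≤ ℓ * ((n + ℓ) ∸ (2 * k)))
    × (m * (k C d) < k * (n ∸ k) → m * (ℓ C d) < ℓ * ((n + ℓ) ∸ (2 * k)))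
lemma3p5 m n k d ℓ 2k≤n+ℓ _ ℓ≤k d≤ℓ 2≤d 2≤m
  with coordinates {n} ℓ≤k 2k≤n+ℓ
... | j , A , refl , n∸k≡j+A , n+ℓ∸2k≡A rewrite n∸k≡j+A | n+ℓ∸2k≡A = λ hk →
  bound-descends-≤ 2≤m 2≤d d≤ℓ j A hk , bound-descends-< 2≤m 2≤d d≤ℓ j A
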